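{- Let $G=(V,E)$ be a finite graph, let $u=(v_{\mathrm{start}},v_{\mathrm{goal}})$ be a query, let $w:E\to[0,+\infty]$ be the true edge weight function and $w_{\mathrm{est}}:E\to[0,+\infty]$ an estimate. Run the Lazy Shortest Path algorithm (LazySP, described in the context) with a subroutine ShortestPath that is complete, and with an edge selector Selector such that, on every call, the set $E_{\mathrm{selected}}$ it returns contains at least one edge of $p_{\mathrm{candidate}}$ not in $E_{\mathrm{eval}}$. Then LazySP is complete, i.e. it terminates after finitely many iterations, returning a path.
   Context: A path is a sequence of adjacent edges joining two endpoint vertices; for a weight function $c:E\to[0,+\infty]$, $\mathrm{len}(p,c)=\sum_{e\in p}c(e)$. For a query $u=(v_{\mathrm{start}},v_{\mathrm{goal}})$, let $P_u$ be the set of paths from $v_{\mathrm{start}}$ to $v_{\mathrm{goal}}$. A subroutine ShortestPath$(G,u,c)$ returns a path in $P_u$ minimizing $\mathrm{len}(\cdot,c)$; it is complete if it always returns such a path. LazySP$(G,u,w,w_{\mathrm{est}})$: set $E_{\mathrm{eval}}\leftarrow\emptyset$ and $w_{\mathrm{lazy}}(e)\leftarrow w_{\mathrm{est}}(e)$ for all $e\in E$. Then repeat: $p_{\mathrm{candidate}}\leftarrow$ ShortestPath$(G,u,w_{\mathrm{lazy}})$; if every edge of $p_{\mathrm{candidate}}$ lies in $E_{\mathrm{eval}}$, return $p_{\mathrm{candidate}}$; otherwise let $E_{\mathrm{selected}}\leftarrow$ Selector$(G,p_{\mathrm{candidate}})$, and for each $e\in E_{\mathrm{selected}}\setminus E_{\mathrm{eval}}$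 set $w_{\mathrm{lazy}}(e)\leftarrow w(e)$ (an "evaluation" of $e$) and add $e$ to $E_{\mathrm{eval}}$. -}

module Defs where

open import Data.Nat using (ℕ; zero; suc)
open import Data.Fin using (Fin)
open import Data.Fin.Subset using (Subset; _∈_; _∉_; _∪_; ⊥)
open import Data.Fin.Subset.Properties using (_∈?_)
open import Data.Product using (_×_; _,_)
open import Data.Sum using (_⊎_)
open import Data.List using (List; []; _∷_; foldr; map)
open import Data.List.Relation.Unary.All using (All; all?)
open import Relation.Binary.PropositionalEquality using (_≡_)
open import Relation.Nullary using (yes; no)

-- A finite (multi)graph: vertices Fin nV, edges Fin nE, each edge has two endpoints.
-- Edges are undirected: a path may traverse an edge in either direction.
record Graph : Set where
  field
    nV    : ℕ
    nE    : ℕ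
    ends  : Fin nE → Fin nV × Fin nV

open Graph public

Vertex : Graph → Set
Vertex G = Fin (nV G)

Edge : Graph → Set
Edge G = Fin (nE G)

Joins : (G : Graph) → Edge G → Vertex G → Vertex G → Set
Joins G e x y = (ends G e ≡ (x , y)) ⊎ (ends G e ≡ (y , x))

data Path (G : Graph) : Vertex G → Vertex G → Set where
  []  : ∀ {x} → Path G x x
  _∷⟨_⟩_ : ∀ {x y z} (e : Edge G) → Joins G e x y → Path G y z → Path G x z

edges : ∀ {G x y} → Path G x y → List (Edge G)
edges []             = []
edges (e ∷⟨ _ ⟩ p)   = e ∷ edges p

-- The weight domain (abstracting [0,+∞]): a carrier with addition, zero and an order.
record WeightDomain : Set₁ where
  field
    W    : Set
    _⊕_  : W → W → W
    𝟘    : W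
    _≤w_ : W → W → Set

open WeightDomain public

len : (D : WeightDomain) {G : Graph} {x y : Vertex G} → Path G x y → (Edge G → W D) → W D
len D p c = foldr (_⊕_ D) (𝟘 D) (map c (edges p))

ShortestPathRoutine : (D : WeightDomain) (G : Graph) (s g : Vertex G) → Set
ShortestPathRoutine D G s g = (Edge G → W D) → Path G s g

CompleteSP : (D : WeightDomain) (G : Graph) (s g : Vertex G) → ShortestPathRoutine D G s g → Set
CompleteSP D G s g SP = ∀ (c : Edge G → W D) (q : Path G s g) → _≤w_ D (len D (SP c) c) (len D q c)

-- An edge selector.  Besides the candidate path it may consult the current
-- iteration number and the set E_eval of already-evaluated edges.
Selector : (G : Graph) (s g : Vertex G) → Set
Selector G s g = ℕ → Subset (nE G) → Path G s g → Subset (nE G)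

wLazy : (D : WeightDomain) (G : Graph) → (Edge G → W D) → (Edge G → W D) → Subset (nE G) → Edge G → W D
wLazy D G w west Eeval e with e ∈? Eeval
... | yes _ = w e
... | no  _ = west e

data LazyState (G : Graph) (s g : Vertex G) : Set where
  returned : Path G s g → LazyState G s g
  running  : Subset (nE G) → LazyState G s g

candidate : (D : WeightDomain) (G : Graph) (s g : Vertex G) → (w west : Edge G → W D) →
            ShortestPathRoutine D G s g → Subset (nE G) → Path G s g
candidate D G s g w west SP Eeval = SP (wLazy D G w west Eeval)

lazyStep : (D : WeightDomain) (G : Graph) (s g : Vertex G) → (w west : Edge G → W D) →
           ShortestPathRoutine D G s g → Selector G s g → ℕ → Subset (nE G) → LazyState G s g
lazyStep D G s g w west SP Sel k Eeval
  with candidate D G s g w west SP Eeval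
... | p with all? (_∈? Eeval) (edges p)
...   | yes _ = returned p
...   | no  _ = running (Eeval ∪ Sel k Eeval p)

lazyRun : (D : WeightDomain) (G : Graph) (s g : Vertex G) → (w west : Edge G → W D) →
          ShortestPathRoutine D G s g → Selector G s g → ℕ → LazyState G s g
lazyRun D G s g w west SP Sel zero = running ⊥
lazyRun D G s g w west SP Sel (suc k) with lazyRun D G s g w west SP Sel k
... | returned p = returned p
... | running Eeval = lazyStep D G s g w west SP Sel k Eeval

-- Each non-returning iteration evaluates an edge not evaluated before, so after k
-- iterations of an unfinished run at least k edges are evaluated.  A graph with nE
-- edges therefore cannot still be running after nE + 1 iterations.
module Submission where

open import Defs
open import Data.Nat using (ℕ; zero; suc; _≤_; _<_; z≤n; s≤s)
open import Data.Nat.Properties using (≤-trans; <⇒≱)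
open import Data.Fin.Subset using (Subset; _∈_; _∉_; _∪_; ∣_∣)
open import Data.Fin.Subset.Properties using (_∈?_; ∣p∣≤n; p⊂q⇒∣p∣<∣q∣; p⊆p∪q; q⊆p∪q)
open import Data.Product using (Σ; _×_; _,_)
open import Data.Sum using (_⊎_; inj₁; inj₂)
open import Data.List.Relation.Unary.All using (All; all?)
open import Data.List.Relation.Unary.Any using (Any; satisfied)
open import Relation.Binary.PropositionalEquality using (_≡_; refl)
open import Relation.Nullary using (¬_; yes; no)
open import Data.Empty using (⊥-elim)

∉∧∈⇒∣p∣<∣p∪q∣ : ∀ {n} {p q : Subset n} {x} → x ∉ p → x ∈ q → ∣ p ∣ < ∣ p ∪ q ∣
∉∧∈⇒∣p∣<∣p∪q∣ {p = p} {q} x∉p x∈q = p⊂q⇒∣p∣<∣q∣ (p⊆p∪q q , _ , q⊆p∪q p q x∈q , x∉p)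

module LazySP (D : WeightDomain) (G : Graph) (s g : Vertex G)
              (w west : Edge G → W D)
              (SP : ShortestPathRoutine D G s g) (Sel : Selector G s g) where

  run : ℕ → LazyState G s g
  run = lazyRun D G s g w west SP Sel

  cand : Subset (nE G) → Path G s g
  cand = candidate D G s g w west SP

  ReturnsAt : ℕ → Set
  ReturnsAt k = Σ (Path G s g) (λ p → run k ≡ returned p)

  SelectsNewEdge : Set
  SelectsNewEdge = ∀ k Eeval → run k ≡ running Eeval →
    ¬ All (_∈ Eeval) (edges (cand Eeval)) →
    Any (λ e → (e ∉ Eeval) × (e ∈ Sel k Eeval (cand Eeval))) (edges (cand Eeval))

  RunningWithAtLeast : ℕ → ℕ → Set
  RunningWithAtLeast m k = Σ (Subset (nE G)) (λ Eeval → (run k ≡ running Eeval) × (m ≤ ∣ Eeval ∣))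

  module _ (selects-new : SelectsNewEdge) where

    lazyStep-returns-or-grows : ∀ k Eeval → run k ≡ running Eeval →
      Σ (Path G s g) (λ p → lazyStep D G s g w west SP Sel k Eeval ≡ returned p)
      ⊎ Σ (Subset (nE G)) (λ Eeval′ →
          (lazyStep D G s g w west SP Sel k Eeval ≡ running Eeval′) × (∣ Eeval ∣ < ∣ Eeval′ ∣))
    lazyStep-returns-or-grows k Eeval run≡ with all? (_∈? Eeval) (edges (cand Eeval))
    ... | yes _            = inj₁ (_ , refl)
    ... | no not-evaluated with satisfied (selects-new k Eeval run≡ not-evaluated)
    ...   | _ , e∉ , e∈    = inj₂ (_ , refl , ∉∧∈⇒∣p∣<∣p∪q∣ e∉ e∈)

    run-returns-or-grows : ∀ k → ReturnsAt k ⊎ RunningWithAtLeast k k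
    run-returns-or-grows zero = inj₂ (_ , refl , z≤n)
    run-returns-or-grows (suc k) with run k in run≡ | run-returns-or-grows k
    ... | returned p    | _                         = inj₁ (p , refl)
    ... | running _     | inj₁ (_ , ())
    ... | running Eeval | inj₂ (.Eeval , refl , k≤) with lazyStep-returns-or-grows k Eeval run≡
    ...   | inj₁ returns                = inj₁ returns
    ...   | inj₂ (Eeval′ , step≡ , <∣) = inj₂ (Eeval′ , step≡ , ≤-trans (s≤s k≤) <∣)

    returns-after-nE+1 : ReturnsAt (suc (nE G))
    returns-after-nE+1 with run-returns-or-grows (suc (nE G))
    ... | inj₁ returns           = returns
    ... | inj₂ (Eeval , _ , n<) = ⊥-elim (<⇒≱ n< (∣p∣≤n Eeval))

theorem1 : (D : WeightDomain) (G : Graph) (s g : Vertex G)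
    (w west : Edge G → W D)
    (SP : ShortestPathRoutine D G s g) → CompleteSP D G s g SP →
    (Sel : Selector G s g) →
    (∀ (k : ℕ) Eeval → lazyRun D G s g w west SP Sel k ≡ running Eeval →
      ¬ All (_∈ Eeval) (edges (candidate D G s g w west SP Eeval)) →
      Any (λ e → (e ∉ Eeval) × (e ∈ Sel k Eeval (candidate D G s g w west SP Eeval)))
          (edges (candidate D G s g w west SP Eeval))) →
    Σ ℕ (λ k → Σ (Path G s g) (λ p → lazyRun D G s g w west SP Sel k ≡ returned p))
theorem1 D G s g w west SP _ Sel selects-new =
  suc (nE G) , LazySP.returns-after-nE+1 D G s g w west SP Sel selects-new
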